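{- Let $C$ be an $(X,2)$-neighbour transitive code in $H(m,q)$ with minimum distance $\delta\geq 3$, and let $\mathcal J$ be an $X$-invariant partition of $M$. Then for all $J=\{j_1,\dots,j_k\}\in\mathcal J$: (1) the stabiliser in $\chi_J(X)$ of the first entry of $H(k,q)$ (corresponding to $j_1$) induces a $2$-transitive group on $Q$; and (2) for every $\alpha\in C$, the stabiliser $\chi_J(X)_{\pi_J(\alpha)}$ is transitive on the set of entries $J$.
   Context: Let $M=\{1,\dots,m\}$, $Q=\{1,\dots,q\}$, $H(m,q)$ the Hamming graph on $Q^m$ with automorphism group $B\rtimes L$ ($B\cong S_q^m$ acting entrywise, $L\cong S_m$ permuting entries via $\alpha^\sigma=(\alpha_{1\sigma^{ -1}},\dots,\alpha_{m\sigma^{ -1}})$), and $X\le\mathrm{Aut}(H(m,q))$. For a code $C$, $\delta$ is its minimum distance and $C_r$ the set of vertices at Hamming distance exactly $r$ from $C$; $C$ is $(X,s)$-neighbour transitive if $C_0=C,C_1,\dots,C_s$ are each $X$-orbits. A partition of $M$ is $X$-invariant if the induced action of $X$ on $M$ permutes its blocks. For an entry $i$, the stabiliser $Y_i$ of $i$ in a group $Y\le \mathrm{Aut}(H(k,q))$ acts on $Q$ via $(h_1,\dots,h_k)\sigma\mapsto h_i$. For $J=\{j_1,\dots,j_k\}\subseteq M$: $\pi_J(\alpha)=(\alpha_{j_1},\dots,\alpha_{j_k})$; for $x=(h_1,\dots,h_m)\sigma$ in the setwise stabiliser $X_J$, $\chi_J(x)=(h_{j_1},\dots,h_{j_k})\hat\sigma\in\mathrm{Aut}(H(k,q))$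 with $\hat\sigma$ induced by $\sigma$ on $J$ (so $\pi_J(\alpha)^{\chi_J(x)}=\pi_J(\alpha^x)$), and $\chi_J(X)=\{\chi_J(x):x\in X_J\}$, viewed as acting on $H(k,q)$ whose entries are identified with $J$. -}

module Defs where

open import Data.Nat using (ℕ; zero; suc; _≤_)
open import Data.Fin using (Fin; zero; suc)
open import Data.Fin.Permutation using (Permutation′; _⟨$⟩ʳ_; _⟨$⟩ˡ_; _∘ₚ_; flip; id)
open import Data.Vec using (Vec; lookup; tabulate; []; _∷_)
open import Data.Product using (Σ; ∃; _×_; _,_)
open import Relation.Binary.PropositionalEquality using (_≡_; _≢_)
open import Relation.Nullary using (¬_; yes; no)
open import Data.Fin using (_≟_)
open import Function using (_⇔_)

-- The Hamming graph H(m,q): vertices are words of length m over Q = Fin q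
-- (entries M = Fin m; entry "1" of the paper is Fin index zero).

Vertex : ℕ → ℕ → Set
Vertex m q = Vec (Fin q) m

dist : ∀ {m q} → Vertex m q → Vertex m q → ℕ
dist [] [] = zero
dist (a ∷ α) (b ∷ β) with a ≟ b
... | yes _ = dist α β
... | no  _ = suc (dist α β)

-- Aut(H(m,q)) = B ⋊ L : an element x = (h₁,…,h_m)σ with hᵢ ∈ Sym(Q), σ ∈ Sym(M).

record Aut (m q : ℕ) : Set where
  constructor ⟪_,_⟫
  field
    h : Fin m → Permutation′ q
    σ : Permutation′ m
open Aut public

-- Action (right action): α^x = (α^h)^σ, i.e.
-- (α^x)_i = h_{iσ⁻¹}(α_{iσ⁻¹}).
act : ∀ {m q} → Aut m q → Vertex m q → Vertex m q
act x α = tabulate (λ i → h x (σ x ⟨$⟩ˡ i) ⟨$⟩ʳ lookup α (σ x ⟨$⟩ˡ i))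

-- Group operations in B ⋊ L (so that act (x · y) = act y ∘ act x).
idAut : ∀ {m q} → Aut m q
idAut = ⟪ (λ _ → id) , id ⟫

_·_ : ∀ {m q} → Aut m q → Aut m q → Aut m q
x · y = ⟪ (λ j → h x j ∘ₚ h y (σ x ⟨$⟩ʳ j)) , σ x ∘ₚ σ y ⟫

inv : ∀ {m q} → Aut m q → Aut m q
inv x = ⟪ (λ k → flip (h x (σ x ⟨$⟩ˡ k))) , flip (σ x) ⟫

record IsSubgroup {m q : ℕ} (X : Aut m q → Set) : Set where
  field
    id-closed  : X idAut
    mul-closed : ∀ {x y} → X x → X y → X (x · y)
    inv-closed : ∀ {x} → X x → X (inv x)

Code : ℕ → ℕ → Set₁
Code m q = Vertex m q → Set

-- minimum distance δ ≥ 3 (δ is defined, i.e. C has two distinct codewords,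
-- and any two distinct codewords are at distance ≥ 3)
MinDistAtLeast3 : ∀ {m q} → Code m q → Set
MinDistAtLeast3 C =
  (Σ (Vertex _ _) λ α → Σ (Vertex _ _) λ β → C α × C β × α ≢ β) ×
  (∀ α β → C α → C β → α ≢ β → 3 ≤ dist α β)

Cr : ∀ {m q} → Code m q → ℕ → Vertex m q → Set
Cr C r β = (Σ _ λ α → C α × dist α β ≡ r) × (∀ α → C α → r ≤ dist α β)

IsOrbit : ∀ {m q} → (Aut m q → Set) → (Vertex m q → Set) → Set
IsOrbit X S =
  (Σ _ S) ×
  (∀ x α → X x → S α → S (act x α)) ×
  (∀ α β → S α → S β → Σ _ λ x → X x × act x α ≡ β)

NeighbourTransitive2 : ∀ {m q} → (Aut m q → Set) → Code m q → Set
NeighbourTransitive2 X C =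
  IsOrbit X (Cr C 0) × IsOrbit X (Cr C 1) × IsOrbit X (Cr C 2)

-- Partitions of M given by a block-labelling blk : M → Fin b
-- (i, i' in the same block iff blk i ≡ blk i').
-- X-invariant: each σ (x ∈ X) maps blocks onto blocks, i.e. preserves
-- "same block" in both directions.
XInvariant : ∀ {m q b} → (Aut m q → Set) → (Fin m → Fin b) → Set
XInvariant {m} X blk =
  ∀ x → X x → (i i' : Fin m) → (blk i ≡ blk i' ⇔ blk (σ x ⟨$⟩ʳ i) ≡ blk (σ x ⟨$⟩ʳ i'))

-- e : Fin k → Fin m enumerates J = {j₁,…,j_k} (j_{t+1} = e t) as a block of blk.
EnumeratesBlock : ∀ {m b k} → (Fin m → Fin b) → Fin b → (Fin k → Fin m) → Set
EnumeratesBlock {m} {b} {k} blk c e =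
  (∀ t t' → e t ≡ e t' → t ≡ t') × (∀ (i : Fin m) → (blk i ≡ c ⇔ ∃ λ t → e t ≡ i))

proj : ∀ {m q k} → (Fin k → Fin m) → Vertex m q → Vertex k q
proj e α = tabulate (λ t → lookup α (e t))

InSetStab : ∀ {m q k} → (Fin k → Fin m) → Aut m q → Set
InSetStab e x = ∀ t → ∃ λ t' → σ x ⟨$⟩ʳ e t ≡ e t'

-- χ_J(X) ⊆ Aut(H(k,q)): y ∈ χ_J(X) iff y = χ_J(x) for some x ∈ X_J, i.e.
-- y = (h_{j₁},…,h_{j_k})σ̂ with σ̂ the permutation induced by σ on J
-- (equality of permutations taken pointwise).
ChiJ : ∀ {m q k} → (Aut m q → Set) → (Fin k → Fin m) → Aut k q → Set
ChiJ X e y = Σ _ λ x → X x × InSetStab e x ×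
  (∀ t → σ x ⟨$⟩ʳ e t ≡ e (σ y ⟨$⟩ʳ t)) ×
  (∀ t a → h y t ⟨$⟩ʳ a ≡ h x (e t) ⟨$⟩ʳ a)

TwoTransitive : ∀ {q} {A : Set} → (A → Set) → (A → Permutation′ q) → Set
TwoTransitive {q} G f =
  ∀ (a b c d : Fin q) → a ≢ b → c ≢ d →
  Σ _ λ g → G g × f g ⟨$⟩ʳ a ≡ c × f g ⟨$⟩ʳ b ≡ d

-- Let α ∈ C and let
-- β, γ be the neighbours of α obtained by changing entry i to a, resp. entry j to b. An
-- element x ∈ X carrying β to γ fixes α, because α^x is a codeword at distance at most 2
-- from α; comparing β^x = α^x with entry iσ changed to a^(hᵢ) against γ shows that x sends
-- (i , a) to (j , b). So X_α is transitive on entries, and the stabiliser of α and of an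
-- entry i is transitive on the letters other than α_i. A second codeword yields an element
-- of X_i moving α_i, so X_i is transitive on Q with a point stabiliser transitive on the
-- remaining letters: X_i is 2-transitive on Q. Since X permutes the blocks of the
-- partition, every x ∈ X mapping one entry of J into J stabilises J, and χ_J(x) commutes
-- with π_J; both claims therefore descend from X to χ_J(X).
module Submission where

open import Defs
open import Data.Nat using (ℕ; zero; suc; _≤_; _<_; _+_; z≤n; s≤s)
open import Data.Nat.Properties
  using (≤-reflexive; ≤-trans; ≤-antisym; m≤n⇒m≤1+n; +-mono-≤; +-monoʳ-≤; +-suc; n≤1+n; n≢0⇒n>0; <⇒≱)
open import Data.Fin using (Fin; zero; suc; _≟_)
open import Data.Fin.Properties using (¬∀⟶∃¬)
open import Data.Fin.Permutation
  using (Permutation′; permutation; _⟨$⟩ʳ_; _⟨$⟩ˡ_; inverseˡ; inverseʳ)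
open import Data.Vec using (Vec; []; _∷_; lookup; tabulate; _[_]≔_)
open import Data.Vec.Properties
  using (lookup∘tabulate; tabulate∘lookup; tabulate-cong; lookup∘update; lookup∘update′; ≡-dec)
open import Data.Product using (Σ; ∃; _×_; _,_; proj₁; proj₂)
open import Data.Empty using (⊥-elim)
open import Function using (_∘_)
open import Function.Bundles using (Equivalence; Injection)
open import Function.Properties.Inverse using (↔⇒↣)
open import Relation.Binary.PropositionalEquality
open import Relation.Nullary using (yes; no)

open ≡-Reasoning

permute-injective : ∀ {n} (π : Permutation′ n) {a b} → π ⟨$⟩ʳ a ≡ π ⟨$⟩ʳ b → a ≡ b
permute-injective π = Injection.injective (↔⇒↣ π)

lookup-ext : ∀ {n} {A : Set} (α β : Vec A n) → (∀ s → lookup α s ≡ lookup β s) → α ≡ β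
lookup-ext α β α≗β = begin
  α                    ≡⟨ tabulate∘lookup α ⟨
  tabulate (lookup α)  ≡⟨ tabulate-cong α≗β ⟩
  tabulate (lookup β)  ≡⟨ tabulate∘lookup β ⟩
  β                    ∎

dist-self : ∀ {m q} (α : Vertex m q) → dist α α ≡ 0
dist-self []      = refl
dist-self (a ∷ α) with a ≟ a
... | yes _   = dist-self α
... | no a≢a  = ⊥-elim (a≢a refl)

dist≡0⇒≡ : ∀ {m q} (α β : Vertex m q) → dist α β ≡ 0 → α ≡ β
dist≡0⇒≡ []      []      _ = refl
dist≡0⇒≡ (a ∷ α) (b ∷ β) d with a ≟ b
dist≡0⇒≡ (a ∷ α) (b ∷ β) d  | yes refl = cong (a ∷_) (dist≡0⇒≡ α β d)
dist≡0⇒≡ (a ∷ α) (b ∷ β) () | no _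

≢⇒dist>0 : ∀ {m q} {α β : Vertex m q} → α ≢ β → 0 < dist α β
≢⇒dist>0 {α = α} {β} α≢β = n≢0⇒n>0 (α≢β ∘ dist≡0⇒≡ α β)

dist-sym : ∀ {m q} (α β : Vertex m q) → dist α β ≡ dist β α
dist-sym []      []      = refl
dist-sym (a ∷ α) (b ∷ β) with a ≟ b | b ≟ a
... | yes _    | yes _   = dist-sym α β
... | no _     | no _    = cong suc (dist-sym α β)
... | yes refl | no a≢a  = ⊥-elim (a≢a refl)
... | no a≢a   | yes refl = ⊥-elim (a≢a refl)

private
  ≤-+-suc : ∀ {n x y} → n ≤ x + y → n ≤ x + suc y
  ≤-+-suc {x = x} n≤x+y = ≤-trans n≤x+y (+-monoʳ-≤ x (n≤1+n _))

  suc-≤-+-suc : ∀ {n x y} → n ≤ x + y → suc n ≤ x + suc y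
  suc-≤-+-suc {n} {x} {y} n≤x+y = subst (suc n ≤_) (sym (+-suc x y)) (s≤s n≤x+y)

dist-triangle : ∀ {m q} (α β γ : Vertex m q) → dist α γ ≤ dist α β + dist β γ
dist-triangle []      []      []      = z≤n
dist-triangle (a ∷ α) (b ∷ β) (c ∷ γ) with a ≟ c | a ≟ b | b ≟ c
... | yes _   | yes _    | yes _    = dist-triangle α β γ
... | yes _   | yes _    | no _     = ≤-+-suc (dist-triangle α β γ)
... | yes _   | no _     | yes _    = m≤n⇒m≤1+n (dist-triangle α β γ)
... | yes _   | no _     | no _     = m≤n⇒m≤1+n (≤-+-suc (dist-triangle α β γ))
... | no a≢a  | yes refl | yes refl = ⊥-elim (a≢a refl)
... | no _    | yes _    | no _     = suc-≤-+-suc (dist-triangle α β γ)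
... | no _    | no _     | yes _    = s≤s (dist-triangle α β γ)
... | no _    | no _     | no _     = s≤s (≤-+-suc (dist-triangle α β γ))

dist-update : ∀ {m q} (α : Vertex m q) i a → dist α (α [ i ]≔ a) ≤ 1
dist-update (b ∷ α) zero a with b ≟ a
... | yes _ = m≤n⇒m≤1+n (≤-reflexive (dist-self α))
... | no _  = s≤s (≤-reflexive (dist-self α))
dist-update (b ∷ α) (suc i) a with b ≟ b
... | yes _   = dist-update α i a
... | no b≢b  = ⊥-elim (b≢b refl)

update-≢ : ∀ {n} {A : Set} (α : Vec A n) {i a} → a ≢ lookup α i → α [ i ]≔ a ≢ α
update-≢ α {i} {a} a≢αᵢ eq = a≢αᵢ (begin
  a                       ≡⟨ lookup∘update i α a ⟨
  lookup (α [ i ]≔ a) i   ≡⟨ cong (λ v → lookup v i) eq ⟩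
  lookup α i              ∎)

update-cancel : ∀ {n} {A : Set} (α : Vec A n) {i j a b} →
                a ≢ lookup α i → α [ i ]≔ a ≡ α [ j ]≔ b → i ≡ j × a ≡ b
update-cancel α {i} {j} {a} {b} a≢αᵢ eq with j ≟ i
... | yes refl = refl , (begin
  a                       ≡⟨ lookup∘update i α a ⟨
  lookup (α [ i ]≔ a) i   ≡⟨ cong (λ v → lookup v i) eq ⟩
  lookup (α [ i ]≔ b) i   ≡⟨ lookup∘update i α b ⟩
  b                       ∎)
... | no j≢i = ⊥-elim (a≢αᵢ (begin
  a                       ≡⟨ lookup∘update i α a ⟨
  lookup (α [ i ]≔ a) i   ≡⟨ cong (λ v → lookup v i) eq ⟩
  lookup (α [ j ]≔ b) i   ≡⟨ lookup∘update′ (j≢i ∘ sym) α b ⟩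
  lookup α i              ∎))

lookup-act : ∀ {m q} (x : Aut m q) α s →
             lookup (act x α) s ≡ h x (σ x ⟨$⟩ˡ s) ⟨$⟩ʳ lookup α (σ x ⟨$⟩ˡ s)
lookup-act x α s = lookup∘tabulate _ s

lookup-act-image : ∀ {m q} (x : Aut m q) α j →
                   lookup (act x α) (σ x ⟨$⟩ʳ j) ≡ h x j ⟨$⟩ʳ lookup α j
lookup-act-image x α j = begin
  lookup (act x α) (σ x ⟨$⟩ʳ j)          ≡⟨ lookup-act x α (σ x ⟨$⟩ʳ j) ⟩
  h x (σ x ⟨$⟩ˡ (σ x ⟨$⟩ʳ j)) ⟨$⟩ʳ lookup α (σ x ⟨$⟩ˡ (σ x ⟨$⟩ʳ j))
                                         ≡⟨ cong (λ i → h x i ⟨$⟩ʳ lookup α i) (inverseˡ (σ x)) ⟩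
  h x j ⟨$⟩ʳ lookup α j                   ∎

act-update : ∀ {m q} (x : Aut m q) α i a →
             act x (α [ i ]≔ a) ≡ act x α [ σ x ⟨$⟩ʳ i ]≔ (h x i ⟨$⟩ʳ a)
act-update x α i a = lookup-ext _ _ entrywise
  where
  entrywise : ∀ s → lookup (act x (α [ i ]≔ a)) s ≡ lookup (act x α [ σ x ⟨$⟩ʳ i ]≔ (h x i ⟨$⟩ʳ a)) s
  entrywise s with s ≟ σ x ⟨$⟩ʳ i
  ... | yes refl = begin
    lookup (act x (α [ i ]≔ a)) (σ x ⟨$⟩ʳ i)   ≡⟨ lookup-act-image x (α [ i ]≔ a) i ⟩
    h x i ⟨$⟩ʳ lookup (α [ i ]≔ a) i          ≡⟨ cong (h x i ⟨$⟩ʳ_) (lookup∘update i α a) ⟩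
    h x i ⟨$⟩ʳ a                              ≡⟨ lookup∘update (σ x ⟨$⟩ʳ i) (act x α) _ ⟨
    lookup (act x α [ σ x ⟨$⟩ʳ i ]≔ (h x i ⟨$⟩ʳ a)) (σ x ⟨$⟩ʳ i) ∎
  ... | no s≢σi = begin
    lookup (act x (α [ i ]≔ a)) s                        ≡⟨ lookup-act x (α [ i ]≔ a) s ⟩
    h x (σ x ⟨$⟩ˡ s) ⟨$⟩ʳ lookup (α [ i ]≔ a) (σ x ⟨$⟩ˡ s) ≡⟨ cong (h x (σ x ⟨$⟩ˡ s) ⟨$⟩ʳ_) (lookup∘update′ σˡs≢i α a) ⟩
    h x (σ x ⟨$⟩ˡ s) ⟨$⟩ʳ lookup α (σ x ⟨$⟩ˡ s)            ≡⟨ lookup-act x α s ⟨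
    lookup (act x α) s                                   ≡⟨ lookup∘update′ s≢σi (act x α) _ ⟨
    lookup (act x α [ σ x ⟨$⟩ʳ i ]≔ (h x i ⟨$⟩ʳ a)) s      ∎
    where
    σˡs≢i : σ x ⟨$⟩ˡ s ≢ i
    σˡs≢i eq = s≢σi (trans (sym (inverseʳ (σ x))) (cong (σ x ⟨$⟩ʳ_) eq))

Sends : ∀ {m q} → Aut m q → Fin m × Fin q → Fin m × Fin q → Set
Sends x (j , u) (j′ , u′) = σ x ⟨$⟩ʳ j ≡ j′ × h x j ⟨$⟩ʳ u ≡ u′

sends-· : ∀ {m q} (x y : Aut m q) {j j′ j″ u u′ u″} →
          Sends x (j , u) (j′ , u′) → Sends y (j′ , u′) (j″ , u″) → Sends (x · y) (j , u) (j″ , u″)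
sends-· x y (refl , refl) (refl , refl) = refl , refl

sends-inv : ∀ {m q} (x : Aut m q) {j j′ u u′} →
            Sends x (j , u) (j′ , u′) → Sends (inv x) (j′ , u′) (j , u)
sends-inv x {j} (refl , refl) rewrite inverseˡ (σ x) {j} = refl , inverseˡ (h x j)

sends-act : ∀ {m q} (x : Aut m q) α {β j j′} → act x α ≡ β → σ x ⟨$⟩ʳ j ≡ j′ →
            Sends x (j , lookup α j) (j′ , lookup β j′)
sends-act x α {j = j} refl refl = refl , sym (lookup-act-image x α j)

module NeighbourTransitive {m q} (X : Aut m q → Set) (X≤Aut : IsSubgroup X) (C : Code m q)
  (C₀-orbit : IsOrbit X (Cr C 0)) (C₁-orbit : IsOrbit X (Cr C 1))
  (δ≥3 : ∀ α β → C α → C β → α ≢ β → 3 ≤ dist α β) where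

  open IsSubgroup X≤Aut

  codeword-in-C₀ : ∀ {α} → C α → Cr C 0 α
  codeword-in-C₀ {α} Cα = (α , Cα , dist-self α) , λ _ _ → z≤n

  C₀-codeword : ∀ {β} → Cr C 0 β → C β
  C₀-codeword {β} ((α , Cα , d) , _) = subst C (dist≡0⇒≡ α β d) Cα

  act-codeword : ∀ {x α} → X x → C α → C (act x α)
  act-codeword {x} {α} Xx Cα = C₀-codeword (proj₁ (proj₂ C₀-orbit) x α Xx (codeword-in-C₀ Cα))

  codewords-close⇒≡ : ∀ {α β} → C α → C β → dist α β ≤ 2 → α ≡ β
  codewords-close⇒≡ {α} {β} Cα Cβ d≤2 with ≡-dec _≟_ α β
  ... | yes α≡β = α≡β
  ... | no α≢β  = ⊥-elim (<⇒≱ (δ≥3 α β Cα Cβ α≢β) d≤2)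

  neighbour-in-C₁ : ∀ {α i a} → C α → a ≢ lookup α i → Cr C 1 (α [ i ]≔ a)
  neighbour-in-C₁ {α} {i} {a} Cα a≢αᵢ = (α , Cα , dist≡1) , nearest
    where
    α≢β : α ≢ α [ i ]≔ a
    α≢β = update-≢ α a≢αᵢ ∘ sym
    dist≡1 : dist α (α [ i ]≔ a) ≡ 1
    dist≡1 = ≤-antisym (dist-update α i a) (≢⇒dist>0 α≢β)
    nearest : ∀ γ → C γ → 1 ≤ dist γ (α [ i ]≔ a)
    nearest γ Cγ = ≢⇒dist>0 γ≢β
      where
      γ≢β : γ ≢ α [ i ]≔ a
      γ≢β refl = α≢β (codewords-close⇒≡ Cα Cγ (m≤n⇒m≤1+n (dist-update α i a)))

  codeword-stabiliser-sends : ∀ {α i j a b} → C α → a ≢ lookup α i → b ≢ lookup α j →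
    ∃ λ x → X x × act x α ≡ α × Sends x (i , a) (j , b)
  codeword-stabiliser-sends {α} {i} {j} {a} {b} Cα a≢αᵢ b≢αⱼ
    with proj₂ (proj₂ C₁-orbit) _ _ (neighbour-in-C₁ Cα a≢αᵢ) (neighbour-in-C₁ Cα b≢αⱼ)
  ... | x , Xx , β↦γ = x , Xx , fixes , sym (proj₁ cancel) , sym (proj₂ cancel)
    where
    near : dist (act x α) (α [ j ]≔ b) ≤ 1
    near = subst (λ v → dist (act x α) v ≤ 1) (trans (sym (act-update x α i a)) β↦γ)
                 (dist-update (act x α) (σ x ⟨$⟩ʳ i) (h x i ⟨$⟩ʳ a))
    near′ : dist (α [ j ]≔ b) α ≤ 1
    near′ = subst (_≤ 1) (dist-sym α _) (dist-update α j b)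
    fixes : act x α ≡ α
    fixes = codewords-close⇒≡ (act-codeword Xx Cα) Cα
              (≤-trans (dist-triangle (act x α) (α [ j ]≔ b) α) (+-mono-≤ near near′))
    cancel : j ≡ σ x ⟨$⟩ʳ i × b ≡ h x i ⟨$⟩ʳ a
    cancel = update-cancel α b≢αⱼ (begin
      α [ j ]≔ b                                 ≡⟨ β↦γ ⟨
      act x (α [ i ]≔ a)                         ≡⟨ act-update x α i a ⟩
      act x α [ σ x ⟨$⟩ʳ i ]≔ (h x i ⟨$⟩ʳ a)      ≡⟨ cong (λ v → v [ σ x ⟨$⟩ʳ i ]≔ (h x i ⟨$⟩ʳ a)) fixes ⟩
      α [ σ x ⟨$⟩ʳ i ]≔ (h x i ⟨$⟩ʳ a)            ∎)

  module _ {α₀ β₀} (Cα₀ : C α₀) (Cβ₀ : C β₀) (α₀≢β₀ : α₀ ≢ β₀) where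

    differing-entry : ∃ λ p → lookup α₀ p ≢ lookup β₀ p
    differing-entry = ¬∀⟶∃¬ m _ (λ s → lookup α₀ s ≟ lookup β₀ s) (α₀≢β₀ ∘ lookup-ext α₀ β₀)

    another-letter : (w : Fin q) → ∃ λ a → a ≢ w
    another-letter w with differing-entry
    ... | p , α₀ₚ≢β₀ₚ with lookup α₀ p ≟ w
    ...   | yes refl = lookup β₀ p , α₀ₚ≢β₀ₚ ∘ sym
    ...   | no α₀ₚ≢w = lookup α₀ p , α₀ₚ≢w

    codeword-stabiliser-transitive : ∀ {α} → C α → ∀ i j →
      ∃ λ x → X x × act x α ≡ α × σ x ⟨$⟩ʳ i ≡ j
    codeword-stabiliser-transitive {α} Cα i j =
      let x , Xx , fixes , i↦j , _ = codeword-stabiliser-sends Cα (proj₂ (another-letter (lookup α i)))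
                                                               (proj₂ (another-letter (lookup α j)))
      in  x , Xx , fixes , i↦j

    entry-stabiliser-moves-letter : ∀ i →
      ∃ λ z → X z × ∃ λ w → w ≢ lookup α₀ i × Sends z (i , lookup α₀ i) (i , w)
    entry-stabiliser-moves-letter i =
      let p , α₀ₚ≢β₀ₚ = differing-entry
          x , Xx , α₀↦β₀ = proj₂ (proj₂ C₀-orbit) α₀ β₀ (codeword-in-C₀ Cα₀) (codeword-in-C₀ Cβ₀)
          y , Xy , y-fixes , p′↦p = codeword-stabiliser-transitive Cβ₀ (σ x ⟨$⟩ʳ p) p
          u , Xu , u-fixes , i↦p = codeword-stabiliser-transitive Cα₀ i p
          v , Xv , v-fixes , p↦i = codeword-stabiliser-transitive Cα₀ p i
          v-sends = sends-act v α₀ v-fixes p↦i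
      in  ((u · x) · y) · v , mul-closed (mul-closed (mul-closed Xu Xx) Xy) Xv ,
          h v p ⟨$⟩ʳ lookup β₀ p ,
          (λ eq → α₀ₚ≢β₀ₚ (permute-injective (h v p) (trans (proj₂ v-sends) (sym eq)))) ,
          sends-· ((u · x) · y) v
            (sends-· (u · x) y (sends-· u x (sends-act u α₀ u-fixes i↦p) (sends-act x α₀ α₀↦β₀ refl))
                               (sends-act y β₀ y-fixes p′↦p))
            (proj₁ v-sends , refl)

    entry-stabiliser-transitive : ∀ i v → ∃ λ g → X g × Sends g (i , lookup α₀ i) (i , v)
    entry-stabiliser-transitive i v with v ≟ lookup α₀ i
    ... | yes refl = idAut , id-closed , refl , refl
    ... | no v≢α₀ᵢ =
      let z , Xz , w , w≢α₀ᵢ , z-sends = entry-stabiliser-moves-letter i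
          g , Xg , _ , g-sends = codeword-stabiliser-sends Cα₀ w≢α₀ᵢ v≢α₀ᵢ
      in  z · g , mul-closed Xz Xg , sends-· z g z-sends g-sends

    entry-stabiliser-sends-reference-pair : ∀ i a b → a ≢ b →
      ∃ λ f → X f × Sends f (i , lookup α₀ i) (i , a)
                  × Sends f (i , proj₁ (another-letter (lookup α₀ i))) (i , b)
    entry-stabiliser-sends-reference-pair i a b a≢b =
      let t , Xt , t-sends = entry-stabiliser-transitive i a
          b′≢α₀ᵢ : h t i ⟨$⟩ˡ b ≢ lookup α₀ i
          b′≢α₀ᵢ eq = a≢b (begin
            a                          ≡⟨ proj₂ t-sends ⟨
            h t i ⟨$⟩ʳ lookup α₀ i      ≡⟨ cong (h t i ⟨$⟩ʳ_) eq ⟨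
            h t i ⟨$⟩ʳ (h t i ⟨$⟩ˡ b)    ≡⟨ inverseʳ (h t i) ⟩
            b                          ∎)
          k , Xk , k-fixes , k-sends = codeword-stabiliser-sends Cα₀ (proj₂ (another-letter (lookup α₀ i))) b′≢α₀ᵢ
      in  k · t , mul-closed Xk Xt ,
          sends-· k t (sends-act k α₀ k-fixes (proj₁ k-sends)) t-sends ,
          sends-· k t k-sends (proj₁ t-sends , inverseʳ (h t i))

    entry-stabiliser-2-transitive : ∀ i (a b c d : Fin q) → a ≢ b → c ≢ d →
      ∃ λ g → X g × Sends g (i , a) (i , c) × Sends g (i , b) (i , d)
    entry-stabiliser-2-transitive i a b c d a≢b c≢d =
      let f , Xf , f-sends₁ , f-sends₂ = entry-stabiliser-sends-reference-pair i a b a≢b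
          g , Xg , g-sends₁ , g-sends₂ = entry-stabiliser-sends-reference-pair i c d c≢d
      in  inv f · g , mul-closed (inv-closed Xf) Xg ,
          sends-· (inv f) g (sends-inv f f-sends₁) g-sends₁ ,
          sends-· (inv f) g (sends-inv f f-sends₂) g-sends₂

induced-permutation : ∀ {m k} {e : Fin k → Fin m} → (∀ t t′ → e t ≡ e t′ → t ≡ t′) →
  (π : Permutation′ m) (f g : Fin k → Fin k) →
  (∀ t → e (f t) ≡ π ⟨$⟩ʳ e t) → (∀ t → e (g t) ≡ π ⟨$⟩ˡ e t) → Permutation′ k
induced-permutation {e = e} e-injective π f g e∘f e∘g = permutation f g f∘g≗id g∘f≗id
  where
  f∘g≗id : ∀ t → f (g t) ≡ t
  f∘g≗id t = e-injective _ _ (begin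
    e (f (g t))          ≡⟨ e∘f (g t) ⟩
    π ⟨$⟩ʳ e (g t)        ≡⟨ cong (π ⟨$⟩ʳ_) (e∘g t) ⟩
    π ⟨$⟩ʳ (π ⟨$⟩ˡ e t)    ≡⟨ inverseʳ π ⟩
    e t                  ∎)
  g∘f≗id : ∀ t → g (f t) ≡ t
  g∘f≗id t = e-injective _ _ (begin
    e (g (f t))          ≡⟨ e∘g (f t) ⟩
    π ⟨$⟩ˡ e (f t)        ≡⟨ cong (π ⟨$⟩ˡ_) (e∘f t) ⟩
    π ⟨$⟩ˡ (π ⟨$⟩ʳ e t)    ≡⟨ inverseˡ π ⟩
    e t                  ∎)

module Restriction {m q b k} (X : Aut m q → Set) {blk : Fin m → Fin b} (blk-invariant : XInvariant X blk)
  {c : Fin b} {e : Fin k → Fin m} (J-block : EnumeratesBlock blk c e) where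

  private
    in-J : ∀ i → blk i ≡ c → ∃ λ t → e t ≡ i
    in-J i = Equivalence.to (proj₂ J-block i)

    blk-e : ∀ t → blk (e t) ≡ c
    blk-e t = Equivalence.from (proj₂ J-block (e t)) (t , refl)

  module _ {x} (Xx : X x) {t₀ t₁} (et₀↦et₁ : σ x ⟨$⟩ʳ e t₀ ≡ e t₁) where

    σ-maps-J : ∀ t → blk (σ x ⟨$⟩ʳ e t) ≡ c
    σ-maps-J t = begin
      blk (σ x ⟨$⟩ʳ e t)   ≡⟨ Equivalence.to (blk-invariant x Xx (e t) (e t₀)) (trans (blk-e t) (sym (blk-e t₀))) ⟩
      blk (σ x ⟨$⟩ʳ e t₀)  ≡⟨ cong blk et₀↦et₁ ⟩
      blk (e t₁)           ≡⟨ blk-e t₁ ⟩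
      c                    ∎

    σ⁻¹-maps-J : ∀ t → blk (σ x ⟨$⟩ˡ e t) ≡ c
    σ⁻¹-maps-J t = trans (Equivalence.from (blk-invariant x Xx (σ x ⟨$⟩ˡ e t) (e t₀)) same-block) (blk-e t₀)
      where
      same-block : blk (σ x ⟨$⟩ʳ (σ x ⟨$⟩ˡ e t)) ≡ blk (σ x ⟨$⟩ʳ e t₀)
      same-block = begin
        blk (σ x ⟨$⟩ʳ (σ x ⟨$⟩ˡ e t))  ≡⟨ cong blk (inverseʳ (σ x)) ⟩
        blk (e t)                    ≡⟨ blk-e t ⟩
        c                            ≡⟨ σ-maps-J t₀ ⟨
        blk (σ x ⟨$⟩ʳ e t₀)           ∎

    private
      image : ∀ t → ∃ λ t′ → e t′ ≡ σ x ⟨$⟩ʳ e t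
      image t = in-J _ (σ-maps-J t)

      preimage : ∀ t → ∃ λ t′ → e t′ ≡ σ x ⟨$⟩ˡ e t
      preimage t = in-J _ (σ⁻¹-maps-J t)

    χ : Aut k q
    χ = ⟪ (λ t → h x (e t))
        , induced-permutation (proj₁ J-block) (σ x) (λ t → proj₁ (image t)) (λ t → proj₁ (preimage t))
                              (λ t → proj₂ (image t)) (λ t → proj₂ (preimage t)) ⟫

    χ∈χJ : ChiJ X e χ
    χ∈χJ = x , Xx , (λ t → proj₁ (image t) , sym (proj₂ (image t))) , (λ t → sym (proj₂ (image t))) , λ _ _ → refl

    σχ : σ χ ⟨$⟩ʳ t₀ ≡ t₁
    σχ = proj₁ J-block _ _ (trans (proj₂ (image t₀)) et₀↦et₁)

    act-χ-proj : ∀ α → act χ (proj e α) ≡ proj e (act x α)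
    act-χ-proj α = tabulate-cong entrywise
      where
      entrywise : ∀ s → h x (e (proj₁ (preimage s))) ⟨$⟩ʳ lookup (proj e α) (proj₁ (preimage s))
                        ≡ lookup (act x α) (e s)
      entrywise s = begin
        h x (e s′) ⟨$⟩ʳ lookup (proj e α) s′          ≡⟨ cong (h x (e s′) ⟨$⟩ʳ_) (lookup∘tabulate _ s′) ⟩
        h x (e s′) ⟨$⟩ʳ lookup α (e s′)               ≡⟨ cong (λ j → h x j ⟨$⟩ʳ lookup α j) (proj₂ (preimage s)) ⟩
        h x (σ x ⟨$⟩ˡ e s) ⟨$⟩ʳ lookup α (σ x ⟨$⟩ˡ e s) ≡⟨ lookup-act x α (e s) ⟨
        lookup (act x α) (e s)                       ∎
        where s′ = proj₁ (preimage s)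

proposition3p4 : ∀ {m q : ℕ} (X : Aut m q → Set) → IsSubgroup X →
    (C : Code m q) → NeighbourTransitive2 X C → MinDistAtLeast3 C →
    ∀ {b : ℕ} (blk : Fin m → Fin b) → XInvariant X blk →
    ∀ (c : Fin b) {k : ℕ} (e : Fin (suc k) → Fin m) → EnumeratesBlock blk c e →
    TwoTransitive (λ y → ChiJ X e y × σ y ⟨$⟩ʳ zero ≡ zero) (λ y → h y zero)
    × (∀ α → C α → ∀ (t t' : Fin (suc k)) →
         Σ (Aut (suc k) q) λ y → ChiJ X e y × act y (proj e α) ≡ proj e α × σ y ⟨$⟩ʳ t ≡ t')
proposition3p4 X X≤Aut C (C₀-orbit , C₁-orbit , _) ((α₀ , β₀ , Cα₀ , Cβ₀ , α₀≢β₀) , δ≥3)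
               blk blk-invariant _ e J-block =
  (λ a b c d a≢b c≢d →
     let g , Xg , (e₀↦e₀ , a↦c) , (_ , b↦d) =
           entry-stabiliser-2-transitive Cα₀ Cβ₀ α₀≢β₀ (e zero) a b c d a≢b c≢d
     in  χ Xg e₀↦e₀ , (χ∈χJ Xg e₀↦e₀ , σχ Xg e₀↦e₀) , a↦c , b↦d) ,
  (λ α Cα t t′ →
     let x , Xx , x-fixes , et↦et′ = codeword-stabiliser-transitive Cα₀ Cβ₀ α₀≢β₀ Cα (e t) (e t′)
     in  χ Xx et↦et′ , χ∈χJ Xx et↦et′ , trans (act-χ-proj Xx et↦et′ α) (cong (proj e) x-fixes) ,
         σχ Xx et↦et′)
  where
  open NeighbourTransitive X X≤Aut C C₀-orbit C₁-orbit δ≥3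
  open Restriction X blk-invariant J-block
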